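{- Let $M=A\otimes B$ where $A$ is an $m\times m$ complex matrix and $B$ is an $n\times n$ complex matrix. For any two integers $r_1,r_2$, \[ \textsf{r}_M(r_1n+r_2m)\le \textsf{r}_A(r_1)\,\textsf{r}_B(r_2). \]
   Context: $\otimes$ is the Kronecker product. For a matrix $M$ and real $r$, $\textsf{r}_M(r)$ is the smallest $s$ such that $M=E+F$ with $E$ having at most $s$ nonzero entries in each row and each column and $\operatorname{rank}(F)\le r$ (over $\mathbb{C}$). -}

module Defs where

open import Level using (Level; _⊔_; suc)
open import Data.Nat using (ℕ; _≤_)
import Data.Nat as ℕ
import Data.Fin as F
open import Data.Fin using (Fin; remQuot)
open import Data.Product using (Σ; _×_; _,_; ∃)
open import Data.List using (List; length)
open import Data.List.Membership.Propositional using (_∉_)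
open import Relation.Nullary using (¬_)
open import Algebra.Bundles using (CommutativeRing)

record Field (c ℓ : Level) : Set (suc (c ⊔ ℓ)) where
  field
    commutativeRing : CommutativeRing c ℓ
  open CommutativeRing commutativeRing public
  field
    0≉1 : ¬ (0# ≈ 1#)
    inverse : ∀ x → ¬ (x ≈ 0#) → Σ Carrier λ y → (x * y) ≈ 1#

module _ {c ℓ : Level} (K : Field c ℓ) where
  open Field K

  Mat : ℕ → ℕ → Set c
  Mat m n = Fin m → Fin n → Carrier

  ∑ : (n : ℕ) → (Fin n → Carrier) → Carrier
  ∑ ℕ.zero f = 0#
  ∑ (ℕ.suc n) f = f F.zero + ∑ n (λ i → f (F.suc i))

  _·_ : ∀ {m k n} → Mat m k → Mat k n → Mat m n
  _·_ {k = k} U V i j = ∑ k (λ t → U i t * V t j)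

  _⊕_ : ∀ {m n} → Mat m n → Mat m n → Mat m n
  (E ⊕ F) i j = E i j + F i j

  _≈ᴹ_ : ∀ {m n} → Mat m n → Mat m n → Set ℓ
  M ≈ᴹ N = ∀ i j → M i j ≈ N i j

  -- Kronecker product: row index (i,i') ↦ i * p + i' (Data.Fin.combine),
  -- decoded with remQuot.
  _⊗_ : ∀ {m n p q} → Mat m n → Mat p q → Mat (m ℕ.* p) (n ℕ.* q)
  _⊗_ {p = p} {q = q} A B k l with remQuot p k | remQuot q l
  ... | (i , i') | (j , j') = A i j * B i' j'

  RankAtMost : ∀ {m n} → ℕ → Mat m n → Set (c ⊔ ℓ)
  RankAtMost {m} {n} r F = Σ (Mat m r) λ U → Σ (Mat r n) λ V → (U · V) ≈ᴹ F

  RowsSparse : ∀ {m n} → ℕ → Mat m n → Set ℓ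
  RowsSparse {m} {n} s E = ∀ (i : Fin m) → Σ (List (Fin n)) λ L →
    (length L ≤ s) × (∀ j → j ∉ L → E i j ≈ 0#)

  ColsSparse : ∀ {m n} → ℕ → Mat m n → Set ℓ
  ColsSparse {m} {n} s E = ∀ (j : Fin n) → Σ (List (Fin m)) λ L →
    (length L ≤ s) × (∀ i → i ∉ L → E i j ≈ 0#)

  -- r_M(r) ≤ s : M = E + F with E having at most s nonzero entries in each
  -- row and column and rank F ≤ r.  (r_M(r) is the least such s.)
  RigidityAtMost : ∀ {m n} → Mat m n → ℕ → ℕ → Set (c ⊔ ℓ)
  RigidityAtMost {m} {n} M r s = Σ (Mat m n) λ E → Σ (Mat m n) λ F →
    RowsSparse s E × ColsSparse s E × RankAtMost r F × (M ≈ᴹ (E ⊕ F))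

{-# OPTIONS --safe #-}
module Submission where

-- Write A = E + F and B = E′ + F′ with E, E′ sparse and F, F′ of low rank, so that
-- A ⊗ B = E ⊗ E′ + (F ⊗ B + E ⊗ F′).  A row (column) of E ⊗ E′ is supported on the
-- product of the supports of a row (column) of E and of E′, which gives the sparsity
-- s₁ s₂.  By the mixed-product property (U V) ⊗ (U′ V′) = (U ⊗ U′)(V ⊗ V′), rank is
-- submultiplicative under ⊗; as rank B ≤ n and rank E ≤ m, the second summand has
-- rank at most r₁ n + m r₂.

open import Defs
open import Level using (Level)
open import Data.Nat as ℕ using (ℕ; zero; suc; _≤_)
import Data.Nat.Properties as ℕₚ
open import Data.Fin as Fin using (Fin; remQuot; combine; _↑ˡ_; _↑ʳ_)
open import Data.Fin.Properties using (remQuot-combine; combine-remQuot)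
open import Data.Vec.Functional using (Vector; _++_)
open import Data.Vec.Functional.Properties using (lookup-++ˡ; lookup-++ʳ)
open import Data.Product using (Σ; _×_; _,_; proj₁; proj₂)
open import Data.List using (List; []; _∷_; length; map; cartesianProductWith)
open import Data.List.Properties using (length-++; length-map)
open import Data.List.Membership.Propositional using (_∉_)
open import Data.List.Membership.Propositional.Properties using (∈-cartesianProductWith⁺)
import Data.List.Membership.DecPropositional as DecMembership
open import Relation.Nullary using (yes; no; contradiction)
open import Relation.Binary.PropositionalEquality as ≡ using (_≡_; cong; cong₂; subst)
open import Function using (_∘_)
import Algebra.Properties.CommutativeSemigroup as CommutativeSemigroupProperties
import Algebra.Properties.Semiring.Sum as SemiringSum

length-cartesianProductWith : ∀ {a b c} {A : Set a} {B : Set b} {C : Set c}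
  (f : A → B → C) (xs : List A) (ys : List B) →
  length (cartesianProductWith f xs ys) ≡ length xs ℕ.* length ys
length-cartesianProductWith f [] ys = ≡.refl
length-cartesianProductWith f (x ∷ xs) ys =
  ≡.trans (length-++ (map (f x) ys))
          (cong₂ ℕ._+_ (length-map (f x) ys) (length-cartesianProductWith f xs ys))

module _ {c ℓ : Level} (K : Field c ℓ) where
  open Field K
  open SemiringSum semiring
    using (sum; sum-cong-≋; sum-cong-≗; sum-replicate-zero; *-distribˡ-sum; *-distribʳ-sum)
  open CommutativeSemigroupProperties *-commutativeSemigroup using (interchange)
  open import Relation.Binary.Reasoning.Setoid setoid

  ∑≡sum : ∀ n (f : Vector Carrier n) → ∑ K n f ≡ sum f
  ∑≡sum zero    f = ≡.refl
  ∑≡sum (suc n) f = cong (f Fin.zero +_) (∑≡sum n (f ∘ Fin.suc))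

  sum-↑ : ∀ m {n} (f : Vector Carrier (m ℕ.+ n)) →
    sum f ≈ sum (λ i → f (i ↑ˡ n)) + sum (λ j → f (m ↑ʳ j))
  sum-↑ zero    f = sym (+-identityˡ _)
  sum-↑ (suc m) f = trans (+-congˡ (sum-↑ m (f ∘ Fin.suc))) (sym (+-assoc _ _ _))

  sum-combine : ∀ m n (f : Vector Carrier (m ℕ.* n)) →
    sum f ≈ sum (λ i → sum (λ j → f (combine {m} {n} i j)))
  sum-combine zero    n f = refl
  sum-combine (suc m) n f = trans (sum-↑ n f) (+-congˡ (sum-combine m n (f ∘ (n ↑ʳ_))))

  sum-*-sum : ∀ {m n} (x : Vector Carrier m) (y : Vector Carrier n) →
    sum x * sum y ≈ sum (λ i → sum (λ j → x i * y j))
  sum-*-sum x y = trans (*-distribʳ-sum (sum y) x) (sum-cong-≋ (λ i → *-distribˡ-sum (x i) y))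

  ·-entry : ∀ {m k n} (U : Mat K m k) (V : Mat K k n) i j →
    _·_ K U V i j ≈ sum (λ t → U i t * V t j)
  ·-entry {k = k} U V i j = reflexive (∑≡sum k _)

  𝟙 : ∀ {n} → Mat K n n
  𝟙 Fin.zero    Fin.zero    = 1#
  𝟙 Fin.zero    (Fin.suc _) = 0#
  𝟙 (Fin.suc _) Fin.zero    = 0#
  𝟙 (Fin.suc i) (Fin.suc j) = 𝟙 i j

  𝟙-sym : ∀ {n} (i j : Fin n) → 𝟙 i j ≡ 𝟙 j i
  𝟙-sym Fin.zero    Fin.zero    = ≡.refl
  𝟙-sym Fin.zero    (Fin.suc _) = ≡.refl
  𝟙-sym (Fin.suc _) Fin.zero    = ≡.refl
  𝟙-sym (Fin.suc i) (Fin.suc j) = 𝟙-sym i j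

  sum-𝟙ˡ : ∀ {n} (i : Fin n) (x : Vector Carrier n) → sum (λ t → 𝟙 i t * x t) ≈ x i
  sum-𝟙ˡ {suc n} Fin.zero x = begin
    1# * x Fin.zero + sum (λ t → 0# * x (Fin.suc t))
      ≈⟨ +-cong (*-identityˡ _) (trans (sum-cong-≋ {n} (λ t → zeroˡ _)) (sum-replicate-zero n)) ⟩
    x Fin.zero + 0#
      ≈⟨ +-identityʳ _ ⟩
    x Fin.zero ∎
  sum-𝟙ˡ {suc n} (Fin.suc i) x = begin
    0# * x Fin.zero + sum (λ t → 𝟙 i t * x (Fin.suc t))
      ≈⟨ +-cong (zeroˡ _) (sum-𝟙ˡ i (x ∘ Fin.suc)) ⟩
    0# + x (Fin.suc i)
      ≈⟨ +-identityˡ _ ⟩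
    x (Fin.suc i) ∎

  sum-𝟙ʳ : ∀ {n} (j : Fin n) (x : Vector Carrier n) → sum (λ t → x t * 𝟙 t j) ≈ x j
  sum-𝟙ʳ j x = trans (sum-cong-≋ (λ t → trans (*-comm _ _) (reflexive (cong (_* x t) (𝟙-sym t j)))))
                     (sum-𝟙ˡ j x)

  ·-identityˡ : ∀ {m n} (M : Mat K m n) → _≈ᴹ_ K (_·_ K 𝟙 M) M
  ·-identityˡ M i j = trans (·-entry 𝟙 M i j) (sum-𝟙ˡ i (λ t → M t j))

  ·-identityʳ : ∀ {m n} (M : Mat K m n) → _≈ᴹ_ K (_·_ K M 𝟙) M
  ·-identityʳ M i j = trans (·-entry M 𝟙 i j) (sum-𝟙ʳ j (M i))

  _⊗ᵛ_ : ∀ {m n} → Vector Carrier m → Vector Carrier n → Vector Carrier (m ℕ.* n)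
  _⊗ᵛ_ {m} {n} x y k = x (proj₁ (remQuot {m} n k)) * y (proj₂ (remQuot {m} n k))

  ⊗ᵛ-combine : ∀ {m n} (x : Vector Carrier m) (y : Vector Carrier n) i j →
    (x ⊗ᵛ y) (combine i j) ≡ x i * y j
  ⊗ᵛ-combine {m} {n} x y i j =
    cong (λ ij → x (proj₁ ij) * y (proj₂ ij)) (remQuot-combine {m} {n} i j)

  -- RowsSparse s E unfolds to ∀ i → Sparse s (E i), and row k of E ⊗ E′ is
  -- definitionally a ⊗ᵛ of rows of E and E′.
  Sparse : ∀ {n} → ℕ → Vector Carrier n → Set ℓ
  Sparse {n} s x = Σ (List (Fin n)) λ L → length L ≤ s × (∀ j → j ∉ L → x j ≈ 0#)

  Sparse-⊗ᵛ : ∀ {m n s t} {x : Vector Carrier m} {y : Vector Carrier n} →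
    Sparse s x → Sparse t y → Sparse (s ℕ.* t) (x ⊗ᵛ y)
  Sparse-⊗ᵛ {m} {n} {s} {t} {x} {y} (L , |L|≤s , x≈0) (L′ , |L′|≤t , y≈0) =
    L×L′ , |L×L′|≤st , λ k k∉ → vanishes (proj₁ (remQuot {m} n k)) (proj₂ (remQuot {m} n k))
                                   (subst (_∉ L×L′) (≡.sym (combine-remQuot {m} n k)) k∉)
    where
    L×L′ : List (Fin (m ℕ.* n))
    L×L′ = cartesianProductWith combine L L′

    |L×L′|≤st : length L×L′ ≤ s ℕ.* t
    |L×L′|≤st = subst (_≤ s ℕ.* t) (≡.sym (length-cartesianProductWith combine L L′))
                      (ℕₚ.*-mono-≤ |L|≤s |L′|≤t)

    vanishes : ∀ i j → combine i j ∉ L×L′ → x i * y j ≈ 0#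
    vanishes i j ij∉ with DecMembership._∈?_ Fin._≟_ i L | DecMembership._∈?_ Fin._≟_ j L′
    ... | yes i∈ | yes j∈ = contradiction (∈-cartesianProductWith⁺ combine i∈ j∈) ij∉
    ... | no i∉  | _      = trans (*-congʳ (x≈0 i i∉)) (zeroˡ _)
    ... | yes _  | no j∉  = trans (*-congˡ (y≈0 j j∉)) (zeroʳ _)

  RowsSparse-⊗ : ∀ {m n p q s t} {E : Mat K m n} {E′ : Mat K p q} →
    RowsSparse K s E → RowsSparse K t E′ → RowsSparse K (s ℕ.* t) (_⊗_ K E E′)
  RowsSparse-⊗ {m} {p = p} rows rows′ k =
    Sparse-⊗ᵛ (rows (proj₁ (remQuot {m} p k))) (rows′ (proj₂ (remQuot {m} p k)))

  ColsSparse-⊗ : ∀ {m n p q s t} {E : Mat K m n} {E′ : Mat K p q} →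
    ColsSparse K s E → ColsSparse K t E′ → ColsSparse K (s ℕ.* t) (_⊗_ K E E′)
  -- Columns of E ⊗ E′ are definitionally rows of the Kronecker product of the transposes.
  ColsSparse-⊗ {E = E} {E′} = RowsSparse-⊗ {E = λ j i → E i j} {E′ = λ j i → E′ i j}

  ⊗-cong : ∀ {m n p q} {A A′ : Mat K m n} {B B′ : Mat K p q} →
    _≈ᴹ_ K A A′ → _≈ᴹ_ K B B′ → _≈ᴹ_ K (_⊗_ K A B) (_⊗_ K A′ B′)
  ⊗-cong {m} {n} {p} {q} A≈A′ B≈B′ k l =
    *-cong (A≈A′ (proj₁ (remQuot {m} p k)) (proj₁ (remQuot {n} q l)))
           (B≈B′ (proj₂ (remQuot {m} p k)) (proj₂ (remQuot {n} q l)))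

  ⊗-·-interchange : ∀ {m r n p r′ q}
    (U : Mat K m r) (V : Mat K r n) (U′ : Mat K p r′) (V′ : Mat K r′ q) →
    _≈ᴹ_ K (_⊗_ K (_·_ K U V) (_·_ K U′ V′)) (_·_ K (_⊗_ K U U′) (_⊗_ K V V′))
  ⊗-·-interchange {m} {r} {n} {p} {r′} {q} U V U′ V′ k l = begin
    _·_ K U V i j * _·_ K U′ V′ i′ j′
      ≈⟨ *-cong (·-entry U V i j) (·-entry U′ V′ i′ j′) ⟩
    sum (λ a → U i a * V a j) * sum (λ b → U′ i′ b * V′ b j′)
      ≈⟨ sum-*-sum (λ a → U i a * V a j) (λ b → U′ i′ b * V′ b j′) ⟩
    sum (λ a → sum (λ b → (U i a * V a j) * (U′ i′ b * V′ b j′)))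
      ≈⟨ sum-cong-≋ {r} (λ a → sum-cong-≋ {r′} (λ b → interchange _ _ _ _)) ⟩
    sum (λ a → sum (λ b → (U i a * U′ i′ b) * (V a j * V′ b j′)))
      ≈⟨ sum-cong-≋ {r} (λ a → sum-cong-≋ {r′} (λ b → reflexive (cong₂ _*_
           (⊗ᵛ-combine (U i) (U′ i′) a b) (⊗ᵛ-combine (λ a → V a j) (λ b → V′ b j′) a b)))) ⟨
    sum (λ a → sum (λ b → _⊗_ K U U′ k (combine {r} {r′} a b) * _⊗_ K V V′ (combine a b) l))
      ≈⟨ sum-combine r r′ _ ⟨
    sum (λ t → _⊗_ K U U′ k t * _⊗_ K V V′ t l)
      ≈⟨ ·-entry (_⊗_ K U U′) (_⊗_ K V V′) k l ⟨
    _·_ K (_⊗_ K U U′) (_⊗_ K V V′) k l ∎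
    where
    i = proj₁ (remQuot {m} p k)
    i′ = proj₂ (remQuot {m} p k)
    j = proj₁ (remQuot {n} q l)
    j′ = proj₂ (remQuot {n} q l)

  RankAtMost-rows : ∀ {m n} (M : Mat K m n) → RankAtMost K m M
  RankAtMost-rows M = 𝟙 , M , ·-identityˡ M

  RankAtMost-cols : ∀ {m n} (M : Mat K m n) → RankAtMost K n M
  RankAtMost-cols M = M , 𝟙 , ·-identityʳ M

  RankAtMost-⊗ : ∀ {m n p q r r′} {F : Mat K m n} {G : Mat K p q} →
    RankAtMost K r F → RankAtMost K r′ G → RankAtMost K (r ℕ.* r′) (_⊗_ K F G)
  RankAtMost-⊗ (U , V , UV≈F) (U′ , V′ , U′V′≈G) =
    _⊗_ K U U′ , _⊗_ K V V′ ,
    λ k l → trans (sym (⊗-·-interchange U V U′ V′ k l)) (⊗-cong UV≈F U′V′≈G k l)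

  RankAtMost-⊕ : ∀ {m n r r′} {F G : Mat K m n} →
    RankAtMost K r F → RankAtMost K r′ G → RankAtMost K (r ℕ.+ r′) (_⊕_ K F G)
  RankAtMost-⊕ {r = r} {r′} {F} {G} (U , V , UV≈F) (U′ , V′ , U′V′≈G) =
    (λ i → U i ++ U′ i) , V ++ V′ , λ i j → begin
      _·_ K (λ i → U i ++ U′ i) (V ++ V′) i j
        ≈⟨ ·-entry (λ i → U i ++ U′ i) (V ++ V′) i j ⟩
      sum (λ t → (U i ++ U′ i) t * (V ++ V′) t j)
        ≈⟨ sum-↑ r _ ⟩
      sum (λ t → (U i ++ U′ i) (t ↑ˡ r′) * (V ++ V′) (t ↑ˡ r′) j)
        + sum (λ t → (U i ++ U′ i) (r ↑ʳ t) * (V ++ V′) (r ↑ʳ t) j)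
        ≡⟨ cong₂ _+_
             (sum-cong-≗ {r} (λ t → cong₂ (λ u v → u * v j)
               (lookup-++ˡ (U i) (U′ i) t) (lookup-++ˡ V V′ t)))
             (sum-cong-≗ {r′} (λ t → cong₂ (λ u v → u * v j)
               (lookup-++ʳ (U i) (U′ i) t) (lookup-++ʳ V V′ t))) ⟩
      sum (λ t → U i t * V t j) + sum (λ t → U′ i t * V′ t j)
        ≈⟨ +-cong (trans (sym (·-entry U V i j)) (UV≈F i j))
                  (trans (sym (·-entry U′ V′ i j)) (U′V′≈G i j)) ⟩
      _⊕_ K F G i j ∎

  *-split : ∀ {a e f b e′ f′} → a ≈ e + f → b ≈ e′ + f′ → a * b ≈ e * e′ + (f * b + e * f′)
  *-split {a} {e} {f} {b} {e′} {f′} a≈e+f b≈e′+f′ = begin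
    a * b                          ≈⟨ *-congʳ a≈e+f ⟩
    (e + f) * b                    ≈⟨ distribʳ b e f ⟩
    e * b + f * b                  ≈⟨ +-congʳ (*-congˡ b≈e′+f′) ⟩
    e * (e′ + f′) + f * b          ≈⟨ +-congʳ (distribˡ e e′ f′) ⟩
    (e * e′ + e * f′) + f * b      ≈⟨ +-assoc _ _ _ ⟩
    e * e′ + (e * f′ + f * b)      ≈⟨ +-congˡ (+-comm _ _) ⟩
    e * e′ + (f * b + e * f′)      ∎

  ⊗-split : ∀ {m n p q} {A E F : Mat K m n} {B E′ F′ : Mat K p q} →
    _≈ᴹ_ K A (_⊕_ K E F) → _≈ᴹ_ K B (_⊕_ K E′ F′) →
    _≈ᴹ_ K (_⊗_ K A B) (_⊕_ K (_⊗_ K E E′) (_⊕_ K (_⊗_ K F B) (_⊗_ K E F′)))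
  ⊗-split {m} {n} {p} {q} A≈E⊕F B≈E′⊕F′ k l =
    *-split (A≈E⊕F (proj₁ (remQuot {m} p k)) (proj₁ (remQuot {n} q l)))
            (B≈E′⊕F′ (proj₂ (remQuot {m} p k)) (proj₂ (remQuot {n} q l)))

-- Opened only here: inside the module above, _+_ and _*_ are the field operations.
open import Data.Nat using (_+_; _*_)

lemma4p9 : ∀ {c ℓ : Level} (K : Field c ℓ) (m n : ℕ)
    (A : Mat K m m) (B : Mat K n n) (r₁ r₂ s₁ s₂ : ℕ) →
    RigidityAtMost K A r₁ s₁ → RigidityAtMost K B r₂ s₂ →
    RigidityAtMost K (_⊗_ K A B) (r₁ * n + r₂ * m) (s₁ * s₂)
lemma4p9 K m n A B r₁ r₂ s₁ s₂ (E , F , rowsE , colsE , rankF , A≈E⊕F)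
                               (E′ , F′ , rowsE′ , colsE′ , rankF′ , B≈E′⊕F′) =
  _⊗_ K E E′ , _⊕_ K (_⊗_ K F B) (_⊗_ K E F′) ,
  RowsSparse-⊗ K rowsE rowsE′ , ColsSparse-⊗ K colsE colsE′ ,
  RankAtMost-⊕ K (RankAtMost-⊗ K rankF (RankAtMost-rows K B))
                 (subst (λ r → RankAtMost K r (_⊗_ K E F′)) (ℕₚ.*-comm m r₂)
                        (RankAtMost-⊗ K (RankAtMost-cols K E) rankF′)) ,
  ⊗-split K A≈E⊕F B≈E′⊕F′
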